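{- Let $(A,+)$ and $(B,+)$ be Abelian groups, both of order $n$, and let $f:A\to B$ be a function with perfect nonlinearity $P_{f}=\frac{1}{n}$. For $b\in B$ define $C_{b}=\{x\in A: f(x)=b\}$, and let $C=\bigcup_{b\in B}\{b\}\times C_{b}\subseteq B\times A$. Then $C$ is a partial geometric difference set in $B\times A$ with parameters $(n^{2},n;2n-1,n-1)$.
   Context: For a function $f:A\to B$ between finite Abelian groups with $|B|=m$, set $P_{f}=\max_{0\neq a\in A}\max_{b\in B}\Pr_{x}(f(x+a)-f(x)=b)$, where $x$ is uniformly distributed in $A$; $f$ has perfect nonlinearity if $P_{f}=\frac{1}{m}$. Let $G$ be a finite additive Abelian group of order $v$. For $S\subseteq G$ and $z\in G$, let $\delta_{S}(z)=|\{(x,y)\in S\times S: z=x-y\}|$. Let $v>k>2$ be integers. A $k$-subset $S\subseteq G$ is a partial geometric difference set with parameters $(v,k;\alpha,\beta)$ if there are constants $\alpha,\beta$ such that for every $x\in G$, $\sum_{y\in S}\delta_{S}(x-y)=\alpha$ if $x\in S$ and $=\beta$ if $x\notin S$. -}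

module Defs where

open import Data.Nat using (ℕ; zero; suc; _+_; _*_; _⊔_; _<_)
open import Data.Bool using (Bool; true; false; if_then_else_; _∧_)
open import Data.List using (List; []; _∷_; length; filter; map; foldr; cartesianProduct)
open import Data.Nat.ListAction using (sum)
open import Data.List.Membership.Propositional using (_∈_)
open import Data.List.Membership.Propositional.Properties using (∈-cartesianProduct⁺)
open import Data.List.Relation.Unary.Unique.Propositional using (Unique)
import Data.List.Relation.Unary.Unique.Propositional.Properties as UP
open import Data.Product using (_×_; _,_; proj₁; proj₂)
open import Data.Product.Properties using (≡-dec)
open import Relation.Binary.PropositionalEquality using (_≡_; refl; cong₂; isEquivalence)
open import Relation.Binary.Definitions using (DecidableEquality)
open import Relation.Nullary using (¬_; Dec; yes; no)
open import Relation.Nullary.Decidable using (⌊_⌋; ¬?)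
open import Algebra.Structures using (IsAbelianGroup; IsGroup; IsMonoid; IsSemigroup; IsMagma)

record FiniteAbelianGroup : Set₁ where
  infixl 6 _+ᴳ_ _-ᴳ_
  field
    Carrier        : Set
    _+ᴳ_           : Carrier → Carrier → Carrier
    0ᴳ             : Carrier
    -ᴳ_            : Carrier → Carrier
    isAbelianGroup : IsAbelianGroup _≡_ _+ᴳ_ 0ᴳ -ᴳ_
    _≟ᴳ_           : DecidableEquality Carrier
    elems          : List Carrier
    elems-unique   : Unique elems
    elems-complete : ∀ x → x ∈ elems

  _-ᴳ_ : Carrier → Carrier → Carrier
  x -ᴳ y = x +ᴳ (-ᴳ y)

  order : ℕ
  order = length elems

open FiniteAbelianGroup public

countᴳ : (G : FiniteAbelianGroup) → (Carrier G → Bool) → ℕ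
countᴳ G p = length (filter (λ x → p x Data.Bool.≟ true) (elems G))

sumᴳ : (G : FiniteAbelianGroup) → (Carrier G → ℕ) → ℕ
sumᴳ G h = sum (map h (elems G))

module _ (G H : FiniteAbelianGroup) where
  private
    module G = FiniteAbelianGroup G
    module H = FiniteAbelianGroup H
    module GA = IsAbelianGroup G.isAbelianGroup
    module HA = IsAbelianGroup H.isAbelianGroup

    _⊕_ : G.Carrier × H.Carrier → G.Carrier × H.Carrier → G.Carrier × H.Carrier
    (a , b) ⊕ (c , d) = (G._+ᴳ_ a c , H._+ᴳ_ b d)

    ⊖ : G.Carrier × H.Carrier → G.Carrier × H.Carrier
    ⊖ (a , b) = (G.-ᴳ_ a , H.-ᴳ_ b)

    e : G.Carrier × H.Carrier
    e = (G.0ᴳ , H.0ᴳ)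

    prodIsAbelianGroup : IsAbelianGroup _≡_ _⊕_ e ⊖
    prodIsAbelianGroup = record
      { isGroup = record
        { isMonoid = record
          { isSemigroup = record
            { isMagma = record
              { isEquivalence = isEquivalence
              ; ∙-cong = λ { refl refl → refl } }
            ; assoc = λ { (a , b) (c , d) (x , y) → cong₂ _,_ (GA.assoc a c x) (HA.assoc b d y) } }
          ; identity = (λ { (a , b) → cong₂ _,_ (proj₁ GA.identity a) (proj₁ HA.identity b) })
                     , (λ { (a , b) → cong₂ _,_ (proj₂ GA.identity a) (proj₂ HA.identity b) }) }
        ; inverse = (λ { (a , b) → cong₂ _,_ (proj₁ GA.inverse a) (proj₁ HA.inverse b) })
                  , (λ { (a , b) → cong₂ _,_ (proj₂ GA.inverse a) (proj₂ HA.inverse b) })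
        ; ⁻¹-cong = λ { refl → refl } }
      ; comm = λ { (a , b) (c , d) → cong₂ _,_ (GA.comm a c) (HA.comm b d) } }

  infixr 7 _⊗_
  _⊗_ : FiniteAbelianGroup
  _⊗_ = record
    { Carrier        = G.Carrier × H.Carrier
    ; _+ᴳ_           = _⊕_
    ; 0ᴳ             = e
    ; -ᴳ_            = ⊖
    ; isAbelianGroup = prodIsAbelianGroup
    ; _≟ᴳ_           = ≡-dec G._≟ᴳ_ H._≟ᴳ_
    ; elems          = cartesianProduct G.elems H.elems
    ; elems-unique   = UP.cartesianProduct⁺ G.elems-unique H.elems-unique
    ; elems-complete = λ { (a , b) → ∈-cartesianProduct⁺ (G.elems-complete a) (H.elems-complete b) }
    }

-- For f : A → B, a ∈ A, b ∈ B let N_f(a,b) = |{x ∈ A : f(x+a) - f(x) = b}|,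
-- so Pr_x(f(x+a)-f(x)=b) = N_f(a,b) / |A|.  Then
--   P_f = (max_{a ≠ 0, b} N_f(a,b)) / |A|,
-- and P_f = 1/|B| iff  (max_{a≠0,b} N_f(a,b)) * |B| = |A|.

diffCount : (A B : FiniteAbelianGroup) → (Carrier A → Carrier B) →
            Carrier A → Carrier B → ℕ
diffCount A B f a b =
  countᴳ A (λ x → ⌊ _≟ᴳ_ B (_-ᴳ_ B (f (_+ᴳ_ A x a)) (f x)) b ⌋)

-- numerator of P_f: maximum of N_f(a,b) over a ≠ 0 and b ∈ B
-- (the maximum over an empty index set is taken to be 0)
maxDiffCount : (A B : FiniteAbelianGroup) → (Carrier A → Carrier B) → ℕ
maxDiffCount A B f =
  foldr _⊔_ 0
    (map (λ ab → diffCount A B f (proj₁ ab) (proj₂ ab))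
         (filter (λ ab → ¬? (_≟ᴳ_ A (proj₁ ab) (0ᴳ A)))
                 (cartesianProduct (elems A) (elems B))))

HasPerfectNonlinearity : (A B : FiniteAbelianGroup) → (Carrier A → Carrier B) → Set
HasPerfectNonlinearity A B f = maxDiffCount A B f * order B ≡ order A

δ : (G : FiniteAbelianGroup) → (Carrier G → Bool) → Carrier G → ℕ
δ G S z = length (filter (λ xy → ⌊ _≟ᴳ_ G z (_-ᴳ_ G (proj₁ xy) (proj₂ xy)) ⌋ Data.Bool.≟ true)
                         (filter (λ xy → S (proj₁ xy) ∧ S (proj₂ xy) Data.Bool.≟ true)
                                 (cartesianProduct (elems G) (elems G))))

pgSum : (G : FiniteAbelianGroup) → (Carrier G → Bool) → Carrier G → ℕ
pgSum G S x = sumᴳ G (λ y → if S y then δ G S (_-ᴳ_ G x y) else 0)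

record IsPGDS (G : FiniteAbelianGroup) (S : Carrier G → Bool) (v k α β : ℕ) : Set where
  field
    order≡v : order G ≡ v
    k<v     : k < v
    2<k     : 2 < k
    size≡k  : countᴳ G S ≡ k
    in-S    : ∀ x → S x ≡ true  → pgSum G S x ≡ α
    notin-S : ∀ x → S x ≡ false → pgSum G S x ≡ β

Cᵇ : (A B : FiniteAbelianGroup) → (Carrier A → Carrier B) → Carrier B → Carrier A → Bool
Cᵇ A B f b x = ⌊ _≟ᴳ_ B (f x) b ⌋

graphSet : (A B : FiniteAbelianGroup) → (Carrier A → Carrier B) → Carrier (B ⊗ A) → Bool
graphSet A B f bx = Cᵇ A B f (proj₁ bx) (proj₂ bx)

-- Write N(a, b) for the number of x with f(x + a) - f(x) = b.  Since the
-- N(a, ·) sum to |A| = |B|, the condition P_f = 1/n forces N(a, b) = 1 for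
-- every a ≠ 0.  For the graph C of f one computes δ_C(c, a) = N(a, c), so
--   Σ_{y ∈ C} δ_C((c, u) - y) = Σ_{y ∈ A} N(u - y, c - f(y))
-- has n - 1 summands equal to 1 (those with y ≠ u) and the summand
-- N(0, c - f(u)), which is n if (c, u) ∈ C and 0 otherwise.  Finally n > 2:
-- n = 1 leaves no nonzero a, and for n = 2 the derivative of f in the
-- direction of the nonzero a is constant, since every element of a group of
-- order 2 is its own inverse.
module Submission where

open import Algebra.Bundles using (AbelianGroup)
import Algebra.Properties.AbelianGroup as AbelianGroupProperties
open import Data.Bool using (Bool; true; false; if_then_else_; _∧_)
import Data.Bool as Bool
open import Data.Empty using (⊥-elim)
open import Data.List using (List; []; _∷_; _++_; length; filter; map; foldr; cartesianProduct)
open import Data.List.Membership.Propositional using (_∈_)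
open import Data.List.Membership.Propositional.Properties
  using (∈-filter⁺; ∈-filter⁻; ∈-cartesianProduct⁺)
open import Data.List.Properties using (map-cong; map-∘; map-++; length-++; length-map)
open import Data.List.Relation.Unary.All as All using (All; []; _∷_)
open import Data.List.Relation.Unary.AllPairs using (_∷_)
open import Data.List.Relation.Unary.Any using (here; there)
open import Data.List.Relation.Unary.Unique.Propositional using (Unique)
open import Data.Nat using (ℕ; suc; _+_; _*_; _∸_; _⊔_; _≤_; _<_; z≤n; s≤s; NonZero)
open import Data.Nat.ListAction using (sum)
open import Data.Nat.ListAction.Properties using (sum-++)
open import Data.Nat.Properties
open import Algebra.Properties.CommutativeSemigroup +-commutativeSemigroup
  using () renaming (interchange to +-interchange)
open import Data.Product using (_×_; _,_; proj₁; proj₂; ∃)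
open import Data.Sum using (_⊎_; inj₁; inj₂)
open import Defs
open import Function using (_∘_; mk⇔)
open import Level using (0ℓ)
open import Relation.Binary.PropositionalEquality
open import Relation.Nullary using (¬_; Dec; yes; no; contradiction)
open import Relation.Nullary.Decidable using (⌊_⌋; ¬?; isYes≗does; dec-true; dec-false; does-⇔)

⌊⌋-true : {P : Set} (d : Dec P) → P → ⌊ d ⌋ ≡ true
⌊⌋-true d p = trans (isYes≗does d) (dec-true d p)

⌊⌋-false : {P : Set} (d : Dec P) → ¬ P → ⌊ d ⌋ ≡ false
⌊⌋-false d ¬p = trans (isYes≗does d) (dec-false d ¬p)

⌊⌋-⇔ : {P Q : Set} → (P → Q) → (Q → P) → (d : Dec P) (e : Dec Q) → ⌊ d ⌋ ≡ ⌊ e ⌋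
⌊⌋-⇔ to from d e =
  trans (isYes≗does d) (trans (does-⇔ (mk⇔ to from) d e) (sym (isYes≗does e)))

𝟙 : Bool → ℕ
𝟙 b = if b then 1 else 0

∑ : {X : Set} → List X → (X → ℕ) → ℕ
∑ L h = sum (map h L)

⨆ : {X : Set} → List X → (X → ℕ) → ℕ
⨆ L h = foldr _⊔_ 0 (map h L)

module _ {X : Set} where

  ∑-cong : {g h : X → ℕ} (L : List X) → (∀ x → g x ≡ h x) → ∑ L g ≡ ∑ L h
  ∑-cong L g≗h = cong sum (map-cong g≗h L)

  ∑-zeros : {h : X → ℕ} {L : List X} → All (λ x → h x ≡ 0) L → ∑ L h ≡ 0
  ∑-zeros []             = refl
  ∑-zeros (hx≡0 ∷ h≡0) rewrite hx≡0 = ∑-zeros h≡0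

  ∑-ones : {h : X → ℕ} {L : List X} → All (λ x → h x ≡ 1) L → ∑ L h ≡ length L
  ∑-ones []             = refl
  ∑-ones (hx≡1 ∷ h≡1) rewrite hx≡1 = cong suc (∑-ones h≡1)

  ∑-const-0 : (L : List X) → ∑ L (λ _ → 0) ≡ 0
  ∑-const-0 L = ∑-zeros (All.universal (λ _ → refl) L)

  ∑-const-1 : (L : List X) → ∑ L (λ _ → 1) ≡ length L
  ∑-const-1 L = ∑-ones (All.universal (λ _ → refl) L)

  ∑-+ : (g h : X → ℕ) (L : List X) → ∑ L (λ x → g x + h x) ≡ ∑ L g + ∑ L h
  ∑-+ g h []      = refl
  ∑-+ g h (x ∷ L) = trans (cong (g x + h x +_) (∑-+ g h L)) (+-interchange (g x) (h x) (∑ L g) (∑ L h))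

  ∑-filter : (p : X → Bool) (h : X → ℕ) (L : List X) →
             ∑ (filter (λ x → p x Bool.≟ true) L) h ≡ ∑ L (λ x → if p x then h x else 0)
  ∑-filter p h []      = refl
  ∑-filter p h (x ∷ L) with p x
  ... | true  = cong (h x +_) (∑-filter p h L)
  ... | false = ∑-filter p h L

  length-filter≡∑𝟙 : (p : X → Bool) (L : List X) →
                     length (filter (λ x → p x Bool.≟ true) L) ≡ ∑ L (𝟙 ∘ p)
  length-filter≡∑𝟙 p L =
    trans (sym (∑-const-1 (filter (λ x → p x Bool.≟ true) L))) (∑-filter p (λ _ → 1) L)

  ∑-if-∧ : (s : Bool) (t : X → Bool) (h : X → ℕ) (L : List X) →
           ∑ L (λ x → if s ∧ t x then h x else 0) ≡ (if s then ∑ L (λ x → if t x then h x else 0) else 0)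
  ∑-if-∧ true  t h L = refl
  ∑-if-∧ false t h L = ∑-const-0 L

  ∑-point : {h : X → ℕ} {L : List X} {y : X} → Unique L → y ∈ L →
            (∀ x → x ≢ y → h x ≡ 0) → ∑ L h ≡ h y
  ∑-point {h} {y = y} (y∉L ∷ _) (here refl) h≡0 =
    trans (cong (h y +_) (∑-zeros (All.map (λ y≢x → h≡0 _ (≢-sym y≢x)) y∉L))) (+-identityʳ (h y))
  ∑-point {h} {x ∷ L} (x∉L ∷ unique) (there y∈L) h≡0 =
    trans (cong (_+ ∑ L h) (h≡0 x (All.lookup x∉L y∈L))) (∑-point unique y∈L h≡0)

  ∑-ones-except : {h : X → ℕ} {L : List X} {u : X} → Unique L → u ∈ L →
                  (∀ x → x ≢ u → h x ≡ 1) → ∑ L h + 1 ≡ h u + length L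
  ∑-ones-except {h} {u ∷ L} (u∉L ∷ _) (here refl) h≡1 = begin
    h u + ∑ L h + 1      ≡⟨ cong (λ s → h u + s + 1) (∑-ones (All.map (λ u≢x → h≡1 _ (≢-sym u≢x)) u∉L)) ⟩
    h u + length L + 1   ≡⟨ +-assoc (h u) (length L) 1 ⟩
    h u + (length L + 1) ≡⟨ cong (h u +_) (+-comm (length L) 1) ⟩
    h u + suc (length L) ∎
    where open ≡-Reasoning
  ∑-ones-except {h} {x ∷ L} {u} (x∉L ∷ unique) (there u∈L) h≡1
    rewrite h≡1 x (All.lookup x∉L u∈L) =
    trans (cong suc (∑-ones-except unique u∈L h≡1)) (sym (+-suc (h u) (length L)))

  ∑-≤-length : {h : X → ℕ} (L : List X) → (∀ x → h x ≤ 1) → ∑ L h ≤ length L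
  ∑-≤-length []      h≤1 = z≤n
  ∑-≤-length (x ∷ L) h≤1 = +-mono-≤ (h≤1 x) (∑-≤-length L h≤1)

  ∑≡length⇒all≡1 : {h : X → ℕ} (L : List X) → (∀ x → h x ≤ 1) → ∑ L h ≡ length L →
                   All (λ x → h x ≡ 1) L
  ∑≡length⇒all≡1         []      h≤1 eq = []
  ∑≡length⇒all≡1 {h = h} (x ∷ L) h≤1 eq with h x in hx | h≤1 x
  ... | 0 | _ = ⊥-elim (1+n≰n (subst (_≤ length L) eq (∑-≤-length L h≤1)))
  ... | 1 | _ = hx ∷ ∑≡length⇒all≡1 L h≤1 (suc-injective eq)
  ... | suc (suc _) | s≤s ()

  ≤-⨆ : (h : X → ℕ) {L : List X} {y : X} → y ∈ L → h y ≤ ⨆ L h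
  ≤-⨆ h {x ∷ L} (here refl) = m≤m⊔n (h x) (⨆ L h)
  ≤-⨆ h {x ∷ L} (there y∈L) = ≤-trans (≤-⨆ h y∈L) (m≤n⊔m (h x) (⨆ L h))

  ⨆≢0⇒nonEmpty : (h : X → ℕ) (L : List X) → ⨆ L h ≢ 0 → ∃ (_∈ L)
  ⨆≢0⇒nonEmpty h []      ⨆≢0 = ⊥-elim (⨆≢0 refl)
  ⨆≢0⇒nonEmpty h (x ∷ L) _   = x , here refl

  ∈⇒length-nonZero : {L : List X} {x : X} → x ∈ L → NonZero (length L)
  ∈⇒length-nonZero {_ ∷ _} _ = _

  2≤length : {L : List X} {x y : X} → x ∈ L → y ∈ L → x ≢ y → 2 ≤ length L
  2≤length {_ ∷ []}    (here refl) (here refl) x≢y = ⊥-elim (x≢y refl)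
  2≤length {_ ∷ _ ∷ _} _           _           _   = s≤s (s≤s z≤n)

  length≡2⇒∈-pair : {L : List X} {x y z : X} → length L ≡ 2 → x ∈ L → y ∈ L → x ≢ y →
                    z ∈ L → z ≡ x ⊎ z ≡ y
  length≡2⇒∈-pair {_ ∷ _ ∷ []} _ (here refl)         (here refl)         x≢y _ = ⊥-elim (x≢y refl)
  length≡2⇒∈-pair {_ ∷ _ ∷ []} _ (there (here refl)) (there (here refl)) x≢y _ = ⊥-elim (x≢y refl)
  length≡2⇒∈-pair {_ ∷ _ ∷ []} _ (here refl)         (there (here refl)) _ (here refl)         = inj₁ refl
  length≡2⇒∈-pair {_ ∷ _ ∷ []} _ (here refl)         (there (here refl)) _ (there (here refl)) = inj₂ refl
  length≡2⇒∈-pair {_ ∷ _ ∷ []} _ (there (here refl)) (here refl)         _ (here refl)         = inj₂ refl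
  length≡2⇒∈-pair {_ ∷ _ ∷ []} _ (there (here refl)) (here refl)         _ (there (here refl)) = inj₁ refl

module _ {X Y : Set} where

  ∑-comm : (h : X → Y → ℕ) (L : List X) (M : List Y) →
           ∑ L (λ x → ∑ M (h x)) ≡ ∑ M (λ y → ∑ L (λ x → h x y))
  ∑-comm h []      M = sym (∑-const-0 M)
  ∑-comm h (x ∷ L) M =
    trans (cong (∑ M (h x) +_) (∑-comm h L M)) (sym (∑-+ (h x) (λ y → ∑ L (λ x → h x y)) M))

  ∑-cartesianProduct : (h : X × Y → ℕ) (L : List X) (M : List Y) →
                       ∑ (cartesianProduct L M) h ≡ ∑ L (λ x → ∑ M (λ y → h (x , y)))
  ∑-cartesianProduct h []      M = refl
  ∑-cartesianProduct h (x ∷ L) M = begin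
    sum (map h (map (x ,_) M ++ cartesianProduct L M))
      ≡⟨ cong sum (map-++ h (map (x ,_) M) (cartesianProduct L M)) ⟩
    sum (map h (map (x ,_) M) ++ map h (cartesianProduct L M))
      ≡⟨ sum-++ (map h (map (x ,_) M)) (map h (cartesianProduct L M)) ⟩
    sum (map h (map (x ,_) M)) + ∑ (cartesianProduct L M) h
      ≡⟨ cong₂ _+_ (cong sum (sym (map-∘ M))) (∑-cartesianProduct h L M) ⟩
    ∑ M (λ y → h (x , y)) + ∑ L (λ x → ∑ M (λ y → h (x , y))) ∎
    where open ≡-Reasoning

  length-cartesianProduct : (L : List X) (M : List Y) →
                            length (cartesianProduct L M) ≡ length L * length M
  length-cartesianProduct []      M = refl
  length-cartesianProduct (x ∷ L) M =
    trans (length-++ (map (x ,_) M)) (cong₂ _+_ (length-map (x ,_) M) (length-cartesianProduct L M))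

abelianGroup : FiniteAbelianGroup → AbelianGroup 0ℓ 0ℓ
abelianGroup G = record { isAbelianGroup = isAbelianGroup G }

module Group (G : FiniteAbelianGroup) where
  open FiniteAbelianGroup G public using (_≟ᴳ_; elems; elems-unique; elems-complete)
  open AbelianGroup (abelianGroup G) public
  open AbelianGroupProperties (abelianGroup G) public

module _ (G : FiniteAbelianGroup) where
  private
    module G = Group G

  order-nonZero : NonZero (order G)
  order-nonZero = ∈⇒length-nonZero (G.elems-complete G.ε)

  a≡x-y⇒x≡y∙a : ∀ {a x y} → a ≡ x G.- y → x ≡ y G.∙ a
  a≡x-y⇒x≡y∙a {a} {x} {y} a≡x-y = begin
    x               ≡⟨ G.xyx⁻¹≈y y x ⟨
    y G.∙ x G.- y   ≡⟨ G.assoc y x (y G.⁻¹) ⟩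
    y G.∙ (x G.- y) ≡⟨ cong (y G.∙_) a≡x-y ⟨
    y G.∙ a         ∎
    where open ≡-Reasoning

  order≡2⇒x∙x≡ε : order G ≡ 2 → ∀ x → x G.∙ x ≡ G.ε
  order≡2⇒x∙x≡ε |G|≡2 x with x G.≟ᴳ G.ε
  ... | yes refl = G.identityˡ G.ε
  ... | no  x≢ε with length≡2⇒∈-pair |G|≡2 (G.elems-complete G.ε) (G.elems-complete x)
                                    (≢-sym x≢ε) (G.elems-complete (x G.∙ x))
  ...   | inj₁ x∙x≡ε = x∙x≡ε
  ...   | inj₂ x∙x≡x = ⊥-elim (x≢ε (G.∙-cancelˡ x x G.ε (trans x∙x≡x (sym (G.identityʳ x)))))

  order≡2⇒x⁻¹≡x : order G ≡ 2 → ∀ x → x G.⁻¹ ≡ x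
  order≡2⇒x⁻¹≡x |G|≡2 x = sym (G.inverseʳ-unique x x (order≡2⇒x∙x≡ε |G|≡2 x))

module _ (A B : FiniteAbelianGroup) (f : Carrier A → Carrier B) where
  private
    module A = Group A
    module B = Group B

  derivative : Carrier A → Carrier A → Carrier B
  derivative a x = f (x A.∙ a) B.- f x

  diffCount≡∑𝟙 : ∀ a b → diffCount A B f a b ≡ ∑ A.elems (λ x → 𝟙 ⌊ derivative a x B.≟ᴳ b ⌋)
  diffCount≡∑𝟙 a b = length-filter≡∑𝟙 _ A.elems

  diffCount-constant : ∀ {a d} → (∀ x → derivative a x ≡ d) → diffCount A B f a d ≡ order A
  diffCount-constant {a} {d} Δ≡d = trans (diffCount≡∑𝟙 a d)
    (∑-ones (All.universal (λ x → cong 𝟙 (⌊⌋-true (derivative a x B.≟ᴳ d) (Δ≡d x))) A.elems))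

  diffCount-avoided : ∀ {a b} → (∀ x → derivative a x ≢ b) → diffCount A B f a b ≡ 0
  diffCount-avoided {a} {b} Δ≢b = trans (diffCount≡∑𝟙 a b)
    (∑-zeros (All.universal (λ x → cong 𝟙 (⌊⌋-false (derivative a x B.≟ᴳ b) (Δ≢b x))) A.elems))

  ∑-diffCount : ∀ a → ∑ B.elems (diffCount A B f a) ≡ order A
  ∑-diffCount a = begin
    ∑ B.elems (diffCount A B f a)
      ≡⟨ ∑-cong B.elems (diffCount≡∑𝟙 a) ⟩
    ∑ B.elems (λ b → ∑ A.elems (λ x → 𝟙 ⌊ derivative a x B.≟ᴳ b ⌋))
      ≡⟨ ∑-comm (λ x b → 𝟙 ⌊ derivative a x B.≟ᴳ b ⌋) A.elems B.elems ⟨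
    ∑ A.elems (λ x → ∑ B.elems (λ b → 𝟙 ⌊ derivative a x B.≟ᴳ b ⌋))
      ≡⟨ ∑-cong A.elems (λ x → ∑-point B.elems-unique (B.elems-complete (derivative a x))
                                 (λ b b≢Δ → cong 𝟙 (⌊⌋-false _ (b≢Δ ∘ sym)))) ⟩
    ∑ A.elems (λ x → 𝟙 ⌊ derivative a x B.≟ᴳ derivative a x ⌋)
      ≡⟨ ∑-ones (All.universal (λ x → cong 𝟙 (⌊⌋-true _ refl)) A.elems) ⟩
    order A ∎
    where open ≡-Reasoning

  derivative-ε : ∀ {a} → a ≡ A.ε → ∀ x → derivative a x ≡ B.ε
  derivative-ε refl x = trans (cong (λ y → f y B.- f x) (A.identityʳ x)) (B.inverseʳ (f x))

  diffCount-self : ∀ u c →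
    diffCount A B f (u A.- u) (c B.- f u) ≡ (if ⌊ f u B.≟ᴳ c ⌋ then order A else 0)
  diffCount-self u c with f u B.≟ᴳ c
  ... | yes refl = diffCount-constant (λ x →
          trans (derivative-ε (A.inverseʳ u) x) (sym (B.inverseʳ (f u))))
  ... | no fu≢c  = diffCount-avoided (λ x Δ≡c-fu →
          fu≢c (sym (B.x∙y⁻¹≈ε⇒x≈y c (f u) (trans (sym Δ≡c-fu) (derivative-ε (A.inverseʳ u) x)))))

  order≡2⇒derivative-constant : order A ≡ 2 → order B ≡ 2 → ∀ {a} → a ≢ A.ε →
                                ∀ x → derivative a x ≡ derivative a A.ε
  order≡2⇒derivative-constant |A|≡2 |B|≡2 {a} a≢ε x
    with length≡2⇒∈-pair |A|≡2 (A.elems-complete A.ε) (A.elems-complete a) (≢-sym a≢ε)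
                         (A.elems-complete x)
  ... | inj₁ refl = refl
  ... | inj₂ refl = begin
    f (a A.∙ a) B.- f a      ≡⟨ cong (λ z → f z B.- f a) (order≡2⇒x∙x≡ε A |A|≡2 a) ⟩
    f A.ε B.- f a            ≡⟨ B.⁻¹-anti-homo‿- (f a) (f A.ε) ⟨
    (f a B.- f A.ε) B.⁻¹     ≡⟨ order≡2⇒x⁻¹≡x B |B|≡2 _ ⟩
    f a B.- f A.ε            ≡⟨ cong (λ z → f z B.- f A.ε) (A.identityˡ a) ⟨
    f (A.ε A.∙ a) B.- f A.ε  ∎
    where open ≡-Reasoning

HasBalancedDerivatives : (A B : FiniteAbelianGroup) → (Carrier A → Carrier B) → Set
HasBalancedDerivatives A B f = ∀ {a} → a ≢ 0ᴳ A → ∀ b → diffCount A B f a b ≡ 1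

module _ (A B : FiniteAbelianGroup) (f : Carrier A → Carrier B) where
  private
    module A = Group A
    module B = Group B
    module G = Group (B ⊗ A)
    C = graphSet A B f

  ∑-graphSet : (H : Carrier B × Carrier A → ℕ) →
               ∑ G.elems (λ p → if C p then H p else 0) ≡ ∑ A.elems (λ x → H (f x , x))
  ∑-graphSet H = begin
    ∑ G.elems (λ p → if C p then H p else 0)
      ≡⟨ ∑-cartesianProduct _ B.elems A.elems ⟩
    ∑ B.elems (λ b → ∑ A.elems (λ x → if ⌊ f x B.≟ᴳ b ⌋ then H (b , x) else 0))
      ≡⟨ ∑-comm _ B.elems A.elems ⟩
    ∑ A.elems (λ x → ∑ B.elems (λ b → if ⌊ f x B.≟ᴳ b ⌋ then H (b , x) else 0))
      ≡⟨ ∑-cong A.elems (λ x → ∑-point B.elems-unique (B.elems-complete (f x)) (λ b b≢fx →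
           cong (λ s → if s then H (b , x) else 0) (⌊⌋-false _ (b≢fx ∘ sym)))) ⟩
    ∑ A.elems (λ x → if ⌊ f x B.≟ᴳ f x ⌋ then H (f x , x) else 0)
      ≡⟨ ∑-cong A.elems (λ x → cong (λ s → if s then H (f x , x) else 0) (⌊⌋-true _ refl)) ⟩
    ∑ A.elems (λ x → H (f x , x)) ∎
    where open ≡-Reasoning

  countᴳ-graphSet : countᴳ (B ⊗ A) C ≡ order A
  countᴳ-graphSet =
    trans (length-filter≡∑𝟙 C G.elems) (trans (∑-graphSet (λ _ → 1)) (∑-const-1 A.elems))

  δ-graphSet : ∀ c a → δ (B ⊗ A) C (c , a) ≡ diffCount A B f a c
  δ-graphSet c a = begin
    δ (B ⊗ A) C (c , a)
      ≡⟨ length-filter≡∑𝟙 (λ pq → D (proj₁ pq) (proj₂ pq)) (filter (λ pq → C² pq Bool.≟ true) G²) ⟩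
    ∑ (filter (λ pq → C² pq Bool.≟ true) G²) (λ pq → 𝟙 (D (proj₁ pq) (proj₂ pq)))
      ≡⟨ ∑-filter C² _ G² ⟩
    ∑ G² (λ pq → if C² pq then 𝟙 (D (proj₁ pq) (proj₂ pq)) else 0)
      ≡⟨ ∑-cartesianProduct _ G.elems G.elems ⟩
    ∑ G.elems (λ p → ∑ G.elems (λ q → if C p ∧ C q then 𝟙 (D p q) else 0))
      ≡⟨ ∑-cong G.elems (λ p → ∑-if-∧ (C p) C (𝟙 ∘ D p) G.elems) ⟩
    ∑ G.elems (λ p → if C p then ∑ G.elems (λ q → if C q then 𝟙 (D p q) else 0) else 0)
      ≡⟨ ∑-graphSet _ ⟩
    ∑ A.elems (λ x → ∑ G.elems (λ q → if C q then 𝟙 (D (f x , x) q) else 0))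
      ≡⟨ ∑-cong A.elems (λ x → ∑-graphSet _) ⟩
    ∑ A.elems (λ x → ∑ A.elems (λ y → 𝟙 (D (f x , x) (f y , y))))
      ≡⟨ ∑-comm _ A.elems A.elems ⟩
    ∑ A.elems (λ y → ∑ A.elems (λ x → 𝟙 (D (f x , x) (f y , y))))
      ≡⟨ ∑-cong A.elems D-hit-once ⟩
    ∑ A.elems (λ y → 𝟙 ⌊ derivative A B f a y B.≟ᴳ c ⌋)
      ≡⟨ diffCount≡∑𝟙 A B f a c ⟨
    diffCount A B f a c ∎
    where
    open ≡-Reasoning

    G² : List (G.Carrier × G.Carrier)
    G² = cartesianProduct G.elems G.elems

    C² : G.Carrier × G.Carrier → Bool
    C² pq = C (proj₁ pq) ∧ C (proj₂ pq)

    D : G.Carrier → G.Carrier → Bool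
    D p q = ⌊ (c , a) G.≟ᴳ (p G.- q) ⌋

    D-hit-once : ∀ y → ∑ A.elems (λ x → 𝟙 (D (f x , x) (f y , y))) ≡ 𝟙 ⌊ derivative A B f a y B.≟ᴳ c ⌋
    D-hit-once y = trans
      (∑-point A.elems-unique (A.elems-complete (y A.∙ a)) (λ x x≢y∙a →
         cong 𝟙 (⌊⌋-false _ (x≢y∙a ∘ a≡x-y⇒x≡y∙a A ∘ cong proj₂))))
      (cong 𝟙 (⌊⌋-⇔ (λ e → sym (cong proj₁ e)) (λ e → cong₂ _,_ (sym e) (sym (A.xyx⁻¹≈y y a))) _ _))

  pgSum-graphSet : ∀ c u →
    pgSum (B ⊗ A) C (c , u) ≡ ∑ A.elems (λ y → diffCount A B f (u A.- y) (c B.- f y))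
  pgSum-graphSet c u = trans (∑-graphSet _) (∑-cong A.elems (λ y → δ-graphSet _ _))

  pgSum-graphSet-balanced : HasBalancedDerivatives A B f → ∀ c u →
    pgSum (B ⊗ A) C (c , u) + 1 ≡ (if C (c , u) then order A else 0) + order A
  pgSum-graphSet-balanced balanced c u = begin
    pgSum (B ⊗ A) C (c , u) + 1
      ≡⟨ cong (_+ 1) (pgSum-graphSet c u) ⟩
    ∑ A.elems (λ y → diffCount A B f (u A.- y) (c B.- f y)) + 1
      ≡⟨ ∑-ones-except A.elems-unique (A.elems-complete u) (λ y y≢u →
           balanced (y≢u ∘ sym ∘ A.x∙y⁻¹≈ε⇒x≈y u y) (c B.- f y)) ⟩
    diffCount A B f (u A.- u) (c B.- f u) + order A
      ≡⟨ cong (_+ order A) (diffCount-self A B f u c) ⟩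
    (if C (c , u) then order A else 0) + order A ∎
    where open ≡-Reasoning

module _ (A B : FiniteAbelianGroup) (f : Carrier A → Carrier B) (|B|≡|A| : order B ≡ order A)
         (pn : HasPerfectNonlinearity A B f) where
  private
    module A = Group A
    module B = Group B

    nonzeroPairs : List (Carrier A × Carrier B)
    nonzeroPairs = filter (λ ab → ¬? (proj₁ ab A.≟ᴳ A.ε)) (cartesianProduct A.elems B.elems)

    N : Carrier A × Carrier B → ℕ
    N ab = diffCount A B f (proj₁ ab) (proj₂ ab)

  maxDiffCount≡1 : maxDiffCount A B f ≡ 1
  maxDiffCount≡1 = *-cancelʳ-≡ _ 1 (order A) {{order-nonZero A}} (begin
    maxDiffCount A B f * order A ≡⟨ cong (maxDiffCount A B f *_) |B|≡|A| ⟨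
    maxDiffCount A B f * order B ≡⟨ pn ⟩
    order A                      ≡⟨ *-identityˡ (order A) ⟨
    1 * order A                  ∎)
    where open ≡-Reasoning

  perfectNonlinear⇒balanced : HasBalancedDerivatives A B f
  perfectNonlinear⇒balanced {a} a≢ε b =
    All.lookup (∑≡length⇒all≡1 B.elems N≤1 (trans (∑-diffCount A B f a) (sym |B|≡|A|)))
               (B.elems-complete b)
    where
    N≤1 : ∀ b → diffCount A B f a b ≤ 1
    N≤1 b = subst (N (a , b) ≤_) maxDiffCount≡1 (≤-⨆ N (∈-filter⁺ _
      (∈-cartesianProduct⁺ (A.elems-complete a) (B.elems-complete b)) a≢ε))

  ∃≢ε : ∃ (_≢ A.ε)
  ∃≢ε with ⨆≢0⇒nonEmpty N nonzeroPairs (1+n≢0 ∘ trans (sym maxDiffCount≡1))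
  ... | (a , _) , a∈ = a , proj₂ (∈-filter⁻ _ {xs = cartesianProduct A.elems B.elems} a∈)

  order≢2 : order A ≢ 2
  order≢2 |A|≡2 with (a , a≢ε) ← ∃≢ε = contradiction (begin
    1                                           ≡⟨ perfectNonlinear⇒balanced a≢ε _ ⟨
    diffCount A B f a (derivative A B f a A.ε)  ≡⟨ diffCount-constant A B f Δ-constant ⟩
    order A                                     ≡⟨ |A|≡2 ⟩
    2                                           ∎) λ ()
    where
    open ≡-Reasoning
    Δ-constant : ∀ x → derivative A B f a x ≡ derivative A B f a A.ε
    Δ-constant = order≡2⇒derivative-constant A B f |A|≡2 (trans |B|≡|A| |A|≡2) a≢ε

  2<order : 2 < order A
  2<order with (a , a≢ε) ← ∃≢ε =
    ≤∧≢⇒< (2≤length (A.elems-complete a) (A.elems-complete A.ε) a≢ε) (≢-sym order≢2)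

theorem3p7 : (n : ℕ) (A B : FiniteAbelianGroup) →
    order A ≡ n → order B ≡ n →
    (f : Carrier A → Carrier B) →
    HasPerfectNonlinearity A B f →
    IsPGDS (B ⊗ A) (graphSet A B f) (n * n) n (2 * n ∸ 1) (n ∸ 1)
theorem3p7 _ A B refl |B|≡|A| f pn = record
  { order≡v = trans (length-cartesianProduct (elems B) (elems A)) (cong (_* n) |B|≡|A|)
  ; k<v     = m<m*n n n {{order-nonZero A}} (<⇒≤ 2<n)
  ; 2<k     = 2<n
  ; size≡k  = countᴳ-graphSet A B f
  ; in-S    = λ { (c , u) c∈C → +1≡⇒≡∸1 (trans (pgSum+1 c u)
                  (trans (cong (λ s → (if s then n else 0) + n) c∈C) (cong (n +_) (sym (+-identityʳ n))))) }
  ; notin-S = λ { (c , u) c∉C → +1≡⇒≡∸1 (trans (pgSum+1 c u) (cong (λ s → (if s then n else 0) + n) c∉C)) }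
  }
  where
  n : ℕ
  n = order A

  2<n : 2 < n
  2<n = 2<order A B f |B|≡|A| pn

  pgSum+1 : ∀ c u → pgSum (B ⊗ A) (graphSet A B f) (c , u) + 1 ≡ (if graphSet A B f (c , u) then n else 0) + n
  pgSum+1 = pgSum-graphSet-balanced A B f (perfectNonlinear⇒balanced A B f |B|≡|A| pn)

  +1≡⇒≡∸1 : ∀ {s m} → s + 1 ≡ m → s ≡ m ∸ 1
  +1≡⇒≡∸1 {s} s+1≡m = trans (sym (m+n∸n≡m s 1)) (cong (_∸ 1) s+1≡m)
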